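{- For every integer $r \ge 2$ and every $0 < \alpha' < \frac{1}{r}$ there exists $d_0 > 0$ such that for every $0 < d \le d_0$ there exists $\varepsilon_0 > 0$ such that for every $0 < \varepsilon \le \varepsilon_0$ there exists $m_0$ such that for every $m \ge m_0$ the following holds. Let $G$ be an $r$-partite graph with ordered partition $(V_1, \dotsc, V_r)$ and for $i \in [r]$ let $C_i$ be an $m$-subset of $V_i$. Suppose that the sets $C_1, \dotsc, C_r$ are pairwise $(\ge\! d, \varepsilon)$-regular (i.e. $G[C_i,C_j]$ is $(\ge\! d,\varepsilon)$-regular for all $i \ne j$) and that $C_i' \subseteq C_i$ for every $i \in [r]$. If $z$ is a positive integer such that $|C_i \setminus C_i'| + z \le (1-\alpha')m$ for every $i \in [r]$, then there exists a properly terminated $(r-1)$-path $P$ in $G[C_1' \cup \dotsm \cup C_r']$ such that for every $i \in [r]$ the path $P$ intersects $C_i'$ in exactly $z$ vertices.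
   Context: A graph $G$ is an $r$-partite graph with ordered partition $(V_1,\dotsc,V_r)$ if this is a partition of $V(G)$ into independent sets. For disjoint nonempty $A,B$, $G[A,B]$ is the bipartite subgraph of edges between $A$ and $B$, and $d_G(A,B) = e(G[A,B])/(|A||B|)$; $G[A,B]$ is $(d,\varepsilon)$-regular if $d_G(X,Y) = d \pm \varepsilon$ for all $X \subseteq A$, $Y \subseteq B$ with $|X| \ge \varepsilon|A|$, $|Y| \ge \varepsilon |B|$, and $(\ge\! d,\varepsilon)$-regular if it is $(d',\varepsilon)$-regular for some $d' \ge d$. An $(r-1)$-path is a sequence of distinct vertices in which every $r$ consecutive vertices form a clique; an $(r-1)$-path $w_1\dotsm w_p$ ($p \ge r$) is properly terminated if $w_i \in V_i$ and $w_{p-r+i} \in V_i$ for all $i \in [r]$.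
   Formalization: The parameters α′, d, ε, the thresholds d₀, ε₀ and the density d′ witnessing (≥d,ε)-regularity are all taken in ℚ. -}

module Defs where

open import Data.Bool using (Bool; true; false; _∧_; if_then_else_)
open import Data.Nat as ℕ using (ℕ; zero; suc; _∸_)
open import Data.Fin as F using (Fin; toℕ)
open import Data.Fin.Properties using (any?) renaming (_≟_ to _≟ᶠ_)
open import Data.Fin.Subset using (Subset; _∈_; _⊆_; ∣_∣)
open import Data.Vec using (lookup; tabulate)
open import Data.Integer using (+_)
open import Data.Rational using (ℚ; _/_; _*_; _+_; _-_; _≤_)
open import Data.Product using (Σ; ∃; ∃-syntax; _×_)
open import Relation.Binary.PropositionalEquality using (_≡_; _≢_)
open import Relation.Nullary using (does)

record Graph (n : ℕ) : Set where
  field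
    adj     : Fin n → Fin n → Bool
    sym     : ∀ u v → adj u v ≡ adj v u
    irrefl  : ∀ v → adj v v ≡ false
open Graph public

⟦_⟧ : ℕ → ℚ
⟦ k ⟧ = (+ k) / 1

sumFin : ∀ {n} → (Fin n → ℕ) → ℕ
sumFin {zero}  f = 0
sumFin {suc n} f = f F.zero ℕ.+ sumFin (λ i → f (F.suc i))

-- e(G[X,Y]) : number of pairs (x,y) ∈ X × Y with xy ∈ E(G)
-- (for disjoint X, Y this is the number of edges of G[X,Y])
edges : ∀ {n} → Graph n → Subset n → Subset n → ℕ
edges G X Y = sumFin λ x → sumFin λ y →
  if lookup X x ∧ lookup Y y ∧ adj G x y then 1 else 0

-- d_G(X,Y) = d ± ε, written without division:
-- (d - ε)|X||Y| ≤ e(X,Y) ≤ (d + ε)|X||Y|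
DensityWithin : ∀ {n} → Graph n → ℚ → ℚ → Subset n → Subset n → Set
DensityWithin G d ε X Y =
  ((d - ε) * ⟦ ∣ X ∣ ℕ.* ∣ Y ∣ ⟧ ≤ ⟦ edges G X Y ⟧)
  × (⟦ edges G X Y ⟧ ≤ (d + ε) * ⟦ ∣ X ∣ ℕ.* ∣ Y ∣ ⟧)

Regular : ∀ {n} → Graph n → ℚ → ℚ → Subset n → Subset n → Set
Regular {n} G d ε A B = ∀ (X Y : Subset n) → X ⊆ A → Y ⊆ B →
  ε * ⟦ ∣ A ∣ ⟧ ≤ ⟦ ∣ X ∣ ⟧ → ε * ⟦ ∣ B ∣ ⟧ ≤ ⟦ ∣ Y ∣ ⟧ →
  DensityWithin G d ε X Y

RegularGE : ∀ {n} → Graph n → ℚ → ℚ → Subset n → Subset n → Set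
RegularGE G d ε A B = ∃[ d' ] (d ≤ d' × Regular G d' ε A B)

-- (V_1,…,V_r) given by part : Fin n → Fin r (V_i = part⁻¹(i)) is an
-- ordered partition into independent sets
IsRPartite : ∀ {n r} → Graph n → (Fin n → Fin r) → Set
IsRPartite G part = ∀ u v → adj G u v ≡ true → part u ≢ part v

-- A sequence w_0 … w_{p-1} of vertices (0-indexed) is an (r-1)-path:
-- distinct vertices, and any two distinct positions lying in a common
-- window of r consecutive positions are adjacent (i.e. every r consecutive
-- vertices form a clique).
IsPath : ∀ {n} → Graph n → ℕ → (p : ℕ) → (Fin p → Fin n) → Set
IsPath G r p w =
  (∀ i j → w i ≡ w j → i ≡ j)
  × (∀ (i j : Fin p) → i ≢ j →
       (∃[ s ] (s ℕ.≤ toℕ i × s ℕ.≤ toℕ j × toℕ i ℕ.< s ℕ.+ r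
                × toℕ j ℕ.< s ℕ.+ r × s ℕ.+ r ℕ.≤ p)) →
       adj G (w i) (w j) ≡ true)

-- properly terminated (p ≥ r): w_i ∈ V_i and w_{p-r+i} ∈ V_i (0-indexed)
ProperlyTerminated : ∀ {n r} → (Fin n → Fin r) → (p : ℕ) → (Fin p → Fin n) → Set
ProperlyTerminated {r = r} part p w =
  r ℕ.≤ p
  × (∀ (k : Fin p) (i : Fin r) → toℕ k ≡ toℕ i → part (w k) ≡ i)
  × (∀ (k : Fin p) (i : Fin r) → toℕ k ≡ (p ∸ r) ℕ.+ toℕ i → part (w k) ≡ i)

pathVertices : ∀ {n p} → (Fin p → Fin n) → Subset n
pathVertices w = tabulate λ v → does (any? λ k → w k ≟ᶠ v)

-- The path is built greedily, its k-th vertex taken from C'_(k mod r). Together with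
-- the first k vertices we keep, for each of the next r positions k + o, the set T_o of
-- unused vertices of the right class adjacent to every chosen vertex within distance
-- r - 1, with |T_o| ≥ (d/2)^(r-1-o) α'm. By regularity fewer than εm vertices of T_0 have
-- fewer than (d/2)|T_o| neighbours in T_o, and r εm ≤ (d/2)^(r-1) α'm ≤ |T_0|, so some
-- vertex of T_0 is typical towards every T_o. Choosing it shrinks each remaining
-- candidate set by a factor d/2 at worst, and the newly opened set consists of the unused
-- vertices of a class, of which at least α'm are left since each class is visited z times.
module Submission where

open import Defs hiding (sym)
open import Data.Bool using (Bool; true; false; _∧_; if_then_else_)
open import Data.Empty using (⊥-elim)
open import Data.Fin as F using (Fin; toℕ)
import Data.Fin.Properties as F
open import Data.Fin.Subset
  using (Subset; inside; outside; _∈_; _∉_; _⊆_; ∣_∣; _─_; _∩_; ⁅_⁆; Nonempty)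
open import Data.Fin.Subset.Properties
  using ( x∈⁅x⁆; x∈⁅y⁆⇒x≡y; ∣⁅x⁆∣≡1; ∣⊥∣≡0; nonempty?; Empty-unique; p─⊥≡p; drop-∷-⊆; ⊆-trans
        ; p─q⊆p; x∈p∧x≢y⇒x∈p-y; x∈p∧x∉q⇒x∈p─q; x∈p∩q⁺; x∈p∩q⁻; ⊆-antisym; _∈?_)
import Data.Integer as ℤ
import Data.Integer.Properties as ℤ
open import Data.Nat as ℕ using (ℕ; zero; suc; _∸_; z≤n; s≤s; NonZero)
import Data.Nat.Properties as ℕ
open import Data.Nat.DivMod using (_mod_)
open import Data.Nat.Coprimality using (Coprime)
open import Data.Nat.Divisibility using (∣1⇒≡1)
open import Data.Product using (Σ; ∃; ∃-syntax; _×_; _,_; proj₁; proj₂)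
open import Data.Rational
  using (ℚ; mkℚ; _/_; 0ℚ; 1ℚ; ½; _<_; _≤_; _+_; _*_; _-_; -_; _⊓_; *≤*; positive; nonNegative; +-*-rawSemiring)
open import Data.Rational.Properties
open import Data.Rational.Solver using (module +-*-Solver)
open import Data.Sum using (inj₁; inj₂; [_,_]′)
open import Data.Vec using ([]; _∷_; here; there; lookup; tabulate)
open import Data.Vec.Properties using (lookup∘tabulate; lookup-zipWith; []=⇒lookup; lookup⇒[]=)
open import Algebra.Definitions.RawSemiring +-*-rawSemiring using (_^_)
open import Relation.Binary.PropositionalEquality
open import Relation.Binary.Definitions using (tri<; tri≈; tri>)
open import Relation.Nullary using (Dec; yes; no; does)
open import Relation.Nullary.Decidable using (dec-true; dec-false)
open import Function using (_∘_)

private variable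
  p q r : ℚ

-- An opaque copy of ⟦_⟧: ⟦ k ⟧ unfolds to a normal form from which
-- Agda cannot recover k when inferring implicit arguments.
opaque
  ⟪_⟫ : ℕ → ℚ
  ⟪ k ⟫ = ⟦ k ⟧

  ⟪⟫≡⟦⟧ : ∀ k → ⟪ k ⟫ ≡ ⟦ k ⟧
  ⟪⟫≡⟦⟧ k = refl

  private
    coprime-1 : ∀ k → Coprime k 1
    coprime-1 k (_ , d∣1) = ∣1⇒≡1 d∣1

    ⟦⟧≡mkℚ : ∀ k → ⟦ k ⟧ ≡ mkℚ (ℤ.+ k) 0 (coprime-1 k)
    ⟦⟧≡mkℚ k = normalize-coprime (coprime-1 k)

  ⟪⟫-mono-≤ : ∀ {a b} → a ℕ.≤ b → ⟪ a ⟫ ≤ ⟪ b ⟫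
  ⟪⟫-mono-≤ {a} {b} a≤b rewrite ⟦⟧≡mkℚ a | ⟦⟧≡mkℚ b =
    *≤* (subst₂ ℤ._≤_ (sym (ℤ.*-identityʳ (ℤ.+ a))) (sym (ℤ.*-identityʳ (ℤ.+ b))) (ℤ.+≤+ a≤b))

  ⟪⟫-+ : ∀ a b → ⟪ a ℕ.+ b ⟫ ≡ ⟪ a ⟫ + ⟪ b ⟫
  ⟪⟫-+ a b rewrite ⟦⟧≡mkℚ a | ⟦⟧≡mkℚ b = cong (_/ 1)
    (trans (ℤ.pos-+ a b) (sym (cong₂ ℤ._+_ (ℤ.*-identityʳ (ℤ.+ a)) (ℤ.*-identityʳ (ℤ.+ b)))))

  ⟪⟫-* : ∀ a b → ⟪ a ℕ.* b ⟫ ≡ ⟪ a ⟫ * ⟪ b ⟫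
  ⟪⟫-* a b rewrite ⟦⟧≡mkℚ a | ⟦⟧≡mkℚ b = cong (_/ 1) (ℤ.pos-* a b)

  ⟪0⟫ : ⟪ 0 ⟫ ≡ 0ℚ
  ⟪0⟫ = refl

  ⟪1⟫ : ⟪ 1 ⟫ ≡ 1ℚ
  ⟪1⟫ = refl

⟪⟫-nonNeg : ∀ k → 0ℚ ≤ ⟪ k ⟫
⟪⟫-nonNeg k = subst (_≤ ⟪ k ⟫) ⟪0⟫ (⟪⟫-mono-≤ z≤n)

⟪⟫-pos : ∀ {k} → 1 ℕ.≤ k → 0ℚ < ⟪ k ⟫
⟪⟫-pos {k} 1≤k = <-≤-trans (positive⁻¹ 1ℚ) (subst (_≤ ⟪ k ⟫) ⟪1⟫ (⟪⟫-mono-≤ 1≤k))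

+-cancelˡ-≤ : ∀ r → r + p ≤ r + q → p ≤ q
+-cancelˡ-≤ {p} {q} r h = subst₂ _≤_ (neg-r+[r+t]≡t p) (neg-r+[r+t]≡t q) (+-monoʳ-≤ (- r) h)
  where
  open +-*-Solver
  neg-r+[r+t]≡t : ∀ t → (- r) + (r + t) ≡ t
  neg-r+[r+t]≡t = solve 2 (λ r t → (:- r) :+ (r :+ t) := t) refl r

*-pos : 0ℚ < p → 0ℚ < q → 0ℚ < p * q
*-pos {p} {q} 0<p 0<q = positive⁻¹ _ {{pos*pos⇒pos p {{positive 0<p}} q {{positive 0<q}}}}

*-monoˡ-≤′ : 0ℚ ≤ r → p ≤ q → r * p ≤ r * q
*-monoˡ-≤′ {r} 0≤r = *-monoˡ-≤-nonNeg r {{nonNegative 0≤r}}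

*-monoʳ-≤′ : 0ℚ ≤ r → p ≤ q → p * r ≤ q * r
*-monoʳ-≤′ {r} 0≤r = *-monoʳ-≤-nonNeg r {{nonNegative 0≤r}}

⊓-pos : 0ℚ < p → 0ℚ < q → 0ℚ < p ⊓ q
⊓-pos {p} {q} 0<p 0<q with ⊓-sel p q
... | inj₁ p⊓q≡p = subst (0ℚ <_) (sym p⊓q≡p) 0<p
... | inj₂ p⊓q≡q = subst (0ℚ <_) (sym p⊓q≡q) 0<q

^-nonNeg : 0ℚ ≤ p → ∀ e → 0ℚ ≤ p ^ e
^-nonNeg 0≤p zero    = <⇒≤ (positive⁻¹ 1ℚ)
^-nonNeg {p} 0≤p (suc e) = subst (_≤ p * p ^ e) (*-zeroʳ p) (*-monoˡ-≤′ 0≤p (^-nonNeg 0≤p e))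

^-pos : 0ℚ < p → ∀ e → 0ℚ < p ^ e
^-pos 0<p zero    = positive⁻¹ 1ℚ
^-pos 0<p (suc e) = *-pos 0<p (^-pos 0<p e)

^-antimono : 0ℚ ≤ p → p ≤ 1ℚ → ∀ {e e'} → e ℕ.≤ e' → p ^ e' ≤ p ^ e
^-antimono 0≤p p≤1 {zero}  {zero}   z≤n      = ≤-refl
^-antimono {p} 0≤p p≤1 {zero} {suc e'} z≤n = begin
  p * p ^ e'  ≤⟨ *-monoʳ-≤′ (^-nonNeg 0≤p e') p≤1 ⟩
  1ℚ * p ^ e' ≡⟨ *-identityˡ _ ⟩
  p ^ e'      ≤⟨ ^-antimono 0≤p p≤1 {zero} {e'} z≤n ⟩
  1ℚ          ∎
  where open ≤-Reasoning
^-antimono 0≤p p≤1 {suc e} {suc e'} (s≤s e≤e') = *-monoˡ-≤′ 0≤p (^-antimono 0≤p p≤1 e≤e')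

half<d'-ε : ∀ {d d' ε} → 0ℚ < d → d ≤ d' → ε ≤ d * ½ * ½ → d * ½ < d' - ε
half<d'-ε {d} {d'} {ε} 0<d d≤d' ε≤d/4 = begin-strict
  d * ½                 ≡⟨ +-identityʳ _ ⟨
  d * ½ + 0ℚ            <⟨ +-monoʳ-< (d * ½) 0<d/4 ⟩
  d * ½ + d * ½ * ½     ≡⟨ solve 1 (λ d → d :* con ½ :+ d :* con ½ :* con ½ := d :- d :* con ½ :* con ½) refl d ⟩
  d - d * ½ * ½         ≤⟨ +-mono-≤ d≤d' (neg-antimono-≤ ε≤d/4) ⟩
  d' - ε                ∎
  where
  open ≤-Reasoning
  open +-*-Solver
  0<d/4 : 0ℚ < d * ½ * ½
  0<d/4 = *-pos (*-pos 0<d (positive⁻¹ ½)) (positive⁻¹ ½)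

⟪k⟫*ε≤κ : ∀ k {a κ ε} → 0ℚ ≤ κ → a * ⟪ k ⟫ < 1ℚ → ε ≤ κ * a → ⟪ k ⟫ * ε ≤ κ
⟪k⟫*ε≤κ k {a} {κ} {ε} 0≤κ ak<1 ε≤κa = begin
  ⟪ k ⟫ * ε          ≤⟨ *-monoˡ-≤′ (⟪⟫-nonNeg k) ε≤κa ⟩
  ⟪ k ⟫ * (κ * a)    ≡⟨ solve 3 (λ k κ a → k :* (κ :* a) := κ :* (a :* k)) refl ⟪ k ⟫ κ a ⟩
  κ * (a * ⟪ k ⟫)    ≤⟨ *-monoˡ-≤′ 0≤κ (<⇒≤ ak<1) ⟩
  κ * 1ℚ             ≡⟨ *-identityʳ κ ⟩
  κ                  ∎
  where
  open ≤-Reasoning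
  open +-*-Solver

∸≡suc∸suc : ∀ {a b} → b ℕ.< a → a ∸ b ≡ suc (a ∸ suc b)
∸≡suc∸suc {suc a} {zero}  _         = refl
∸≡suc∸suc {suc a} {suc b} (s≤s b<a) = ∸≡suc∸suc b<a

_[_↦_] : ∀ {A : Set} → (ℕ → A) → ℕ → A → ℕ → A
(f [ k ↦ a ]) j = if does (j ℕ.≟ k) then a else f j

[↦]-same : ∀ {A : Set} (f : ℕ → A) k a → (f [ k ↦ a ]) k ≡ a
[↦]-same f k a = cong (if_then a else f k) (dec-true (k ℕ.≟ k) refl)

[↦]-other : ∀ {A : Set} (f : ℕ → A) {k} a {j} → j ≢ k → (f [ k ↦ a ]) j ≡ f j
[↦]-other f {k} a {j} j≢k = cong (if_then a else f j) (dec-false (j ℕ.≟ k) j≢k)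

private variable
  n : ℕ
  x : Fin n

∈-tabulate⁺ : ∀ {f : Fin n → Bool} → f x ≡ true → x ∈ tabulate f
∈-tabulate⁺ {x = x} {f} fx = lookup⇒[]= x (tabulate f) (trans (lookup∘tabulate f x) fx)

∈-tabulate⁻ : ∀ {f : Fin n → Bool} → x ∈ tabulate f → f x ≡ true
∈-tabulate⁻ {x = x} {f} x∈ = trans (sym (lookup∘tabulate f x)) ([]=⇒lookup x∈)

does⇒witness : ∀ {A : Set} (a? : Dec A) → does a? ≡ true → A
does⇒witness (yes a) _ = a

∣p∣>0⇒nonempty : ∀ (P : Subset n) → 0 ℕ.< ∣ P ∣ → Nonempty P
∣p∣>0⇒nonempty {n} P 0<∣P∣ with nonempty? P
... | yes ne = ne
... | no  ¬ne = ⊥-elim (ℕ.<-irrefl (sym (trans (cong ∣_∣ (Empty-unique ¬ne)) (∣⊥∣≡0 n))) 0<∣P∣)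

x∈p─q⁻ : ∀ (P Q : Subset n) → x ∈ P ─ Q → x ∈ P × x ∉ Q
x∈p─q⁻ (inside ∷ P) (outside ∷ Q) here = here , λ ()
x∈p─q⁻ (s ∷ P) (outside ∷ Q) (there x∈) =
  let x∈P , x∉Q = x∈p─q⁻ P Q x∈ in there x∈P , λ { (there x∈Q) → x∉Q x∈Q }
x∈p─q⁻ (s ∷ P) (inside ∷ Q)  (there x∈) =
  let x∈P , x∉Q = x∈p─q⁻ P Q x∈ in there x∈P , λ { (there x∈Q) → x∉Q x∈Q }

∣p∣≤∣p─q∣+∣q∣ : ∀ (P Q : Subset n) → ∣ P ∣ ℕ.≤ ∣ P ─ Q ∣ ℕ.+ ∣ Q ∣
∣p∣≤∣p─q∣+∣q∣ []            []            = z≤n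
∣p∣≤∣p─q∣+∣q∣ (outside ∷ P) (outside ∷ Q) = ∣p∣≤∣p─q∣+∣q∣ P Q
∣p∣≤∣p─q∣+∣q∣ (inside  ∷ P) (outside ∷ Q) = s≤s (∣p∣≤∣p─q∣+∣q∣ P Q)
∣p∣≤∣p─q∣+∣q∣ (outside ∷ P) (inside  ∷ Q) =
  ℕ.≤-trans (∣p∣≤∣p─q∣+∣q∣ P Q) (ℕ.+-monoʳ-≤ ∣ P ─ Q ∣ (ℕ.n≤1+n ∣ Q ∣))
∣p∣≤∣p─q∣+∣q∣ (inside  ∷ P) (inside  ∷ Q) =
  subst (suc ∣ P ∣ ℕ.≤_) (sym (ℕ.+-suc ∣ P ─ Q ∣ ∣ Q ∣)) (s≤s (∣p∣≤∣p─q∣+∣q∣ P Q))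

q⊆p⇒∣p∣≡∣p─q∣+∣q∣ : ∀ (P Q : Subset n) → Q ⊆ P → ∣ P ∣ ≡ ∣ P ─ Q ∣ ℕ.+ ∣ Q ∣
q⊆p⇒∣p∣≡∣p─q∣+∣q∣ []            []            _   = refl
q⊆p⇒∣p∣≡∣p─q∣+∣q∣ (outside ∷ P) (outside ∷ Q) Q⊆P = q⊆p⇒∣p∣≡∣p─q∣+∣q∣ P Q (drop-∷-⊆ Q⊆P)
q⊆p⇒∣p∣≡∣p─q∣+∣q∣ (inside ∷ P)  (outside ∷ Q) Q⊆P = cong suc (q⊆p⇒∣p∣≡∣p─q∣+∣q∣ P Q (drop-∷-⊆ Q⊆P))
q⊆p⇒∣p∣≡∣p─q∣+∣q∣ (inside ∷ P)  (inside ∷ Q)  Q⊆P =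
  trans (cong suc (q⊆p⇒∣p∣≡∣p─q∣+∣q∣ P Q (drop-∷-⊆ Q⊆P))) (sym (ℕ.+-suc ∣ P ─ Q ∣ ∣ Q ∣))
q⊆p⇒∣p∣≡∣p─q∣+∣q∣ (outside ∷ P) (inside ∷ Q)  Q⊆P with Q⊆P here
... | ()

x∈p⇒∣p∣≡1+∣p─x∣ : ∀ (P : Subset n) → x ∈ P → ∣ P ∣ ≡ suc ∣ P ─ ⁅ x ⁆ ∣
x∈p⇒∣p∣≡1+∣p─x∣ {x = x} P x∈P = begin
  ∣ P ∣                       ≡⟨ q⊆p⇒∣p∣≡∣p─q∣+∣q∣ P ⁅ x ⁆ ⁅x⁆⊆P ⟩
  ∣ P ─ ⁅ x ⁆ ∣ ℕ.+ ∣ ⁅ x ⁆ ∣ ≡⟨ cong (∣ P ─ ⁅ x ⁆ ∣ ℕ.+_) (∣⁅x⁆∣≡1 x) ⟩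
  ∣ P ─ ⁅ x ⁆ ∣ ℕ.+ 1         ≡⟨ ℕ.+-comm _ 1 ⟩
  suc ∣ P ─ ⁅ x ⁆ ∣           ∎
  where
  open ≡-Reasoning
  ⁅x⁆⊆P : ⁅ x ⁆ ⊆ P
  ⁅x⁆⊆P y∈⁅x⁆ = subst (_∈ P) (sym (x∈⁅y⁆⇒x≡y x y∈⁅x⁆)) x∈P

x∉p⇒p─x≡p : ∀ (P : Subset n) → x ∉ P → P ─ ⁅ x ⁆ ≡ P
x∉p⇒p─x≡p {x = F.zero}  (inside  ∷ P) x∉P = ⊥-elim (x∉P here)
x∉p⇒p─x≡p {x = F.zero}  (outside ∷ P) x∉P = cong (outside ∷_) (p─⊥≡p P)
x∉p⇒p─x≡p {x = F.suc x} (s ∷ P)       x∉P = cong (s ∷_) (x∉p⇒p─x≡p P (x∉P ∘ there))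

indicator : Bool → ℕ
indicator b = if b then 1 else 0

sumFin-cong : ∀ {f g : Fin n → ℕ} → (∀ x → f x ≡ g x) → sumFin f ≡ sumFin g
sumFin-cong {zero}  f≗g = refl
sumFin-cong {suc n} f≗g = cong₂ ℕ._+_ (f≗g F.zero) (sumFin-cong (f≗g ∘ F.suc))

sumFin-0 : sumFin {n} (λ _ → 0) ≡ 0
sumFin-0 {zero}  = refl
sumFin-0 {suc n} = sumFin-0 {n}

∣p∣≡sum-indicator : ∀ (P : Subset n) → ∣ P ∣ ≡ sumFin (λ x → indicator (lookup P x))
∣p∣≡sum-indicator []            = refl
∣p∣≡sum-indicator (inside  ∷ P) = cong suc (∣p∣≡sum-indicator P)
∣p∣≡sum-indicator (outside ∷ P) = ∣p∣≡sum-indicator P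

sumFin-restricted-≤ : ∀ (b : Fin n → Bool) (f : Fin n → ℕ) c →
  (∀ x → b x ≡ true → ⟪ f x ⟫ ≤ c) →
  ⟪ sumFin (λ x → if b x then f x else 0) ⟫ ≤ ⟪ sumFin (λ x → indicator (b x)) ⟫ * c
sumFin-restricted-≤ {zero}  b f c _     = ≤-reflexive (trans ⟪0⟫ (sym (trans (cong (_* c) ⟪0⟫) (*-zeroˡ c))))
sumFin-restricted-≤ {suc n} b f c f≤c = begin
  ⟪ head ℕ.+ tail ⟫                     ≡⟨ ⟪⟫-+ head tail ⟩
  ⟪ head ⟫ + ⟪ tail ⟫                   ≤⟨ +-mono-≤ head≤ (sumFin-restricted-≤ (b ∘ F.suc) (f ∘ F.suc) c (f≤c ∘ F.suc)) ⟩
  ⟪ count₀ ⟫ * c + ⟪ count ⟫ * c        ≡⟨ *-distribʳ-+ c ⟪ count₀ ⟫ ⟪ count ⟫ ⟨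
  (⟪ count₀ ⟫ + ⟪ count ⟫) * c          ≡⟨ cong (_* c) (⟪⟫-+ count₀ count) ⟨
  ⟪ count₀ ℕ.+ count ⟫ * c              ∎
  where
  open ≤-Reasoning
  head = if b F.zero then f F.zero else 0
  tail = sumFin (λ x → if b (F.suc x) then f (F.suc x) else 0)
  count₀ = indicator (b F.zero)
  count = sumFin (λ x → indicator (b (F.suc x)))
  head≤ : ⟪ head ⟫ ≤ ⟪ count₀ ⟫ * c
  head≤ with b F.zero in b₀
  ... | true  = subst (⟪ f F.zero ⟫ ≤_) (sym (trans (cong (_* c) ⟪1⟫) (*-identityˡ c))) (f≤c F.zero b₀)
  ... | false = ≤-reflexive (trans ⟪0⟫ (sym (trans (cong (_* c) ⟪0⟫) (*-zeroˡ c))))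

∈pathVertices⁺ : ∀ {p} (w : Fin p → Fin n) k → w k ∈ pathVertices w
∈pathVertices⁺ w k = ∈-tabulate⁺ (dec-true (F.any? (λ j → w j F.≟ w k)) (k , refl))

∈pathVertices⁻ : ∀ {p} (w : Fin p → Fin n) {v} → v ∈ pathVertices w → ∃[ k ] (w k ≡ v)
∈pathVertices⁻ w {v} v∈ = does⇒witness (F.any? (λ k → w k F.≟ v)) (∈-tabulate⁻ v∈)

module _ (G : Graph n) where

  neighbours : Fin n → Subset n
  neighbours x = tabulate (adj G x)

  degree : Fin n → Subset n → ℕ
  degree x Y = ∣ Y ∩ neighbours x ∣

  ∈neighbours⁻ : ∀ {v} → v ∈ neighbours x → adj G x v ≡ true
  ∈neighbours⁻ = ∈-tabulate⁻

  ∈neighbours⇒≢ : ∀ {v} → v ∈ neighbours x → v ≢ x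
  ∈neighbours⇒≢ {x = x} v∈N refl with trans (sym (∈neighbours⁻ v∈N)) (irrefl G x)
  ... | ()

  edges≡sum-degree : ∀ X Y → edges G X Y ≡ sumFin (λ x → if lookup X x then degree x Y else 0)
  edges≡sum-degree X Y = sumFin-cong row
    where
    row : ∀ x → sumFin (λ y → indicator (lookup X x ∧ lookup Y y ∧ adj G x y))
              ≡ (if lookup X x then degree x Y else 0)
    row x with lookup X x
    ... | false = sumFin-0 {n}
    ... | true  = sym (trans (∣p∣≡sum-indicator (Y ∩ neighbours x)) (sumFin-cong entry))
      where
      entry : ∀ y → indicator (lookup (Y ∩ neighbours x) y) ≡ indicator (lookup Y y ∧ adj G x y)
      entry y = cong indicator (trans (lookup-zipWith _∧_ y Y (neighbours x))
                                      (cong (lookup Y y ∧_) (lookup∘tabulate (adj G x) y)))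

  edges-≤ : ∀ X Y c → (∀ x → x ∈ X → ⟪ degree x Y ⟫ ≤ c) → ⟪ edges G X Y ⟫ ≤ ⟪ ∣ X ∣ ⟫ * c
  edges-≤ X Y c deg≤c =
    subst₂ (λ e s → ⟪ e ⟫ ≤ ⟪ s ⟫ * c) (sym (edges≡sum-degree X Y)) (sym (∣p∣≡sum-indicator X))
      (sumFin-restricted-≤ (lookup X) (λ x → degree x Y) c
        (λ x Xx → deg≤c x (lookup⇒[]= x X Xx)))

  regular-lower : ∀ {d ε A B X Y} → Regular G d ε A B → X ⊆ A → Y ⊆ B →
    ε * ⟪ ∣ A ∣ ⟫ ≤ ⟪ ∣ X ∣ ⟫ → ε * ⟪ ∣ B ∣ ⟫ ≤ ⟪ ∣ Y ∣ ⟫ →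
    (d - ε) * (⟪ ∣ X ∣ ⟫ * ⟪ ∣ Y ∣ ⟫) ≤ ⟪ edges G X Y ⟫
  regular-lower {d} {ε} {A} {B} {X} {Y} reg X⊆A Y⊆B X-large Y-large =
    subst₂ (λ s e → (d - ε) * s ≤ e) (trans (sym (⟪⟫≡⟦⟧ _)) (⟪⟫-* ∣ X ∣ ∣ Y ∣)) (sym (⟪⟫≡⟦⟧ _))
      (proj₁ (reg X Y X⊆A Y⊆B (⟦⟧-large {A} {X} X-large) (⟦⟧-large {B} {Y} Y-large)))
    where
    ⟦⟧-large : ∀ {Z W : Subset n} → ε * ⟪ ∣ Z ∣ ⟫ ≤ ⟪ ∣ W ∣ ⟫ → ε * ⟦ ∣ Z ∣ ⟧ ≤ ⟦ ∣ W ∣ ⟧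
    ⟦⟧-large {Z} {W} = subst₂ (λ z w → ε * z ≤ w) (⟪⟫≡⟦⟧ ∣ Z ∣) (⟪⟫≡⟦⟧ ∣ W ∣)

  isLow : ℚ → Subset n → Fin n → Bool
  isLow δ Y x = does (⟪ degree x Y ⟫ <? δ * ⟪ ∣ Y ∣ ⟫)

  lowDegree : ℚ → Subset n → Subset n → Subset n
  lowDegree δ X Y = tabulate (λ x → lookup X x ∧ isLow δ Y x)

  lowDegree⊆ : ∀ δ X Y → lowDegree δ X Y ⊆ X
  lowDegree⊆ δ X Y {x} x∈L with lookup X x in Xx | ∈-tabulate⁻ x∈L
  ... | true | _ = lookup⇒[]= x X Xx

  ∈lowDegree⇒ : ∀ δ X Y → x ∈ lowDegree δ X Y → ⟪ degree x Y ⟫ < δ * ⟪ ∣ Y ∣ ⟫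
  ∈lowDegree⇒ {x = x} δ X Y x∈L with lookup X x | ∈-tabulate⁻ x∈L
  ... | true | low = does⇒witness (⟪ degree x Y ⟫ <? δ * ⟪ ∣ Y ∣ ⟫) low

  ∉lowDegree⇒ : ∀ δ X Y → x ∈ X → x ∉ lowDegree δ X Y → δ * ⟪ ∣ Y ∣ ⟫ ≤ ⟪ degree x Y ⟫
  ∉lowDegree⇒ {x = x} δ X Y x∈X x∉L = ≮⇒≥ λ low →
    x∉L (∈-tabulate⁺ (cong₂ _∧_ ([]=⇒lookup x∈X) (dec-true (⟪ degree x Y ⟫ <? δ * ⟪ ∣ Y ∣ ⟫) low)))

  lowDegree-small : ∀ {d d' ε A B X Y} → 0ℚ < d → d ≤ d' → ε ≤ d * ½ * ½ →
    Regular G d' ε A B → X ⊆ A → Y ⊆ B → 0ℚ < ε * ⟪ ∣ A ∣ ⟫ → 0ℚ < ε * ⟪ ∣ B ∣ ⟫ →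
    ε * ⟪ ∣ B ∣ ⟫ ≤ ⟪ ∣ Y ∣ ⟫ → ⟪ ∣ lowDegree (d * ½) X Y ∣ ⟫ < ε * ⟪ ∣ A ∣ ⟫
  lowDegree-small {d} {d'} {ε} {A} {B} {X} {Y} 0<d d≤d' ε≤d/4 reg X⊆A Y⊆B 0<εA 0<εB Y-large =
    ≰⇒> λ L-large → <-irrefl refl (<-≤-trans (half<d'-ε 0<d d≤d' ε≤d/4) (d'-ε≤d/2 L-large))
    where
    L = lowDegree (d * ½) X Y
    d'-ε≤d/2 : ε * ⟪ ∣ A ∣ ⟫ ≤ ⟪ ∣ L ∣ ⟫ → d' - ε ≤ d * ½
    d'-ε≤d/2 L-large = *-cancelʳ-≤-pos (⟪ ∣ L ∣ ⟫ * ⟪ ∣ Y ∣ ⟫) {{positive 0<LY}} (begin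
      (d' - ε) * (⟪ ∣ L ∣ ⟫ * ⟪ ∣ Y ∣ ⟫)
        ≤⟨ regular-lower {d'} {ε} reg (⊆-trans (lowDegree⊆ (d * ½) X Y) X⊆A) Y⊆B L-large Y-large ⟩
      ⟪ edges G L Y ⟫
        ≤⟨ edges-≤ L Y (d * ½ * ⟪ ∣ Y ∣ ⟫) (λ x x∈L → <⇒≤ (∈lowDegree⇒ (d * ½) X Y x∈L)) ⟩
      ⟪ ∣ L ∣ ⟫ * (d * ½ * ⟪ ∣ Y ∣ ⟫)
        ≡⟨ solve 3 (λ l δ y → l :* (δ :* y) := δ :* (l :* y)) refl ⟪ ∣ L ∣ ⟫ (d * ½) ⟪ ∣ Y ∣ ⟫ ⟩
      d * ½ * (⟪ ∣ L ∣ ⟫ * ⟪ ∣ Y ∣ ⟫) ∎)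
      where
      open ≤-Reasoning
      open +-*-Solver
      0<LY : 0ℚ < ⟪ ∣ L ∣ ⟫ * ⟪ ∣ Y ∣ ⟫
      0<LY = *-pos (<-≤-trans 0<εA L-large) (<-≤-trans 0<εB Y-large)

  withoutLow : ℚ → Subset n → (ℕ → Subset n) → ℕ → Subset n
  withoutLow δ S Y zero    = S
  withoutLow δ S Y (suc j) = withoutLow δ S Y j ─ lowDegree δ S (Y (suc j))

  ∈withoutLow⇒ : ∀ δ S Y j → x ∈ withoutLow δ S Y j →
    x ∈ S × (∀ o → 1 ℕ.≤ o → o ℕ.≤ j → x ∉ lowDegree δ S (Y o))
  ∈withoutLow⇒ δ S Y zero    x∈S = x∈S , λ { (suc o) _ () }
  ∈withoutLow⇒ δ S Y (suc j) x∈W with x∈p─q⁻ (withoutLow δ S Y j) _ x∈W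
  ... | x∈W' , x∉L with ∈withoutLow⇒ δ S Y j x∈W'
  ...   | x∈S , x∉Ls = x∈S , λ o 1≤o o≤1+j → [ (λ o≤j → x∉Ls o 1≤o (ℕ.s≤s⁻¹ o≤j))
                                            , (λ { refl → x∉L }) ]′ (ℕ.m≤n⇒m<n∨m≡n o≤1+j)

  withoutLow-size : ∀ δ S Y e j → (∀ o → 1 ℕ.≤ o → o ℕ.≤ j → ⟪ ∣ lowDegree δ S (Y o) ∣ ⟫ ≤ e) →
    ⟪ ∣ S ∣ ⟫ ≤ ⟪ ∣ withoutLow δ S Y j ∣ ⟫ + ⟪ j ⟫ * e
  withoutLow-size δ S Y e zero    _     =
    ≤-reflexive (sym (trans (cong (λ t → ⟪ ∣ S ∣ ⟫ + t * e) ⟪0⟫)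
                            (trans (cong (⟪ ∣ S ∣ ⟫ +_) (*-zeroˡ e)) (+-identityʳ _))))
  withoutLow-size δ S Y e (suc j) L≤e = begin
    ⟪ ∣ S ∣ ⟫                               ≤⟨ withoutLow-size δ S Y e j (λ o 1≤o o≤j → L≤e o 1≤o (ℕ.m≤n⇒m≤1+n o≤j)) ⟩
    ⟪ ∣ W ∣ ⟫ + ⟪ j ⟫ * e                   ≤⟨ +-monoˡ-≤ (⟪ j ⟫ * e) (⟪⟫-mono-≤ (∣p∣≤∣p─q∣+∣q∣ W L)) ⟩
    ⟪ ∣ W ─ L ∣ ℕ.+ ∣ L ∣ ⟫ + ⟪ j ⟫ * e     ≡⟨ cong (_+ ⟪ j ⟫ * e) (⟪⟫-+ ∣ W ─ L ∣ ∣ L ∣) ⟩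
    ⟪ ∣ W ─ L ∣ ⟫ + ⟪ ∣ L ∣ ⟫ + ⟪ j ⟫ * e   ≤⟨ +-monoˡ-≤ (⟪ j ⟫ * e) (+-monoʳ-≤ ⟪ ∣ W ─ L ∣ ⟫ (L≤e (suc j) (s≤s z≤n) ℕ.≤-refl)) ⟩
    ⟪ ∣ W ─ L ∣ ⟫ + e + ⟪ j ⟫ * e           ≡⟨ solve 3 (λ w e j → w :+ e :+ j :* e := w :+ (con 1ℚ :+ j) :* e) refl ⟪ ∣ W ─ L ∣ ⟫ e ⟪ j ⟫ ⟩
    ⟪ ∣ W ─ L ∣ ⟫ + (1ℚ + ⟪ j ⟫) * e        ≡⟨ cong (λ t → ⟪ ∣ W ─ L ∣ ⟫ + (t + ⟪ j ⟫) * e) ⟪1⟫ ⟨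
    ⟪ ∣ W ─ L ∣ ⟫ + (⟪ 1 ⟫ + ⟪ j ⟫) * e     ≡⟨ cong (λ t → ⟪ ∣ W ─ L ∣ ⟫ + t * e) (⟪⟫-+ 1 j) ⟨
    ⟪ ∣ W ─ L ∣ ⟫ + ⟪ suc j ⟫ * e           ∎
    where
    open ≤-Reasoning
    open +-*-Solver
    W = withoutLow δ S Y j
    L = lowDegree δ S (Y (suc j))

  typical-vertex : ∀ δ S Y e j → (∀ o → 1 ℕ.≤ o → o ℕ.≤ j → ⟪ ∣ lowDegree δ S (Y o) ∣ ⟫ ≤ e) →
    ⟪ j ⟫ * e < ⟪ ∣ S ∣ ⟫ →
    ∃[ x ] (x ∈ S × (∀ o → 1 ℕ.≤ o → o ℕ.≤ j → δ * ⟪ ∣ Y o ∣ ⟫ ≤ ⟪ degree x (Y o) ⟫))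
  typical-vertex δ S Y e j L≤e je<S =
    let x , x∈W = ∣p∣>0⇒nonempty W (ℕ.n≢0⇒n>0 W≢∅)
        x∈S , x∉Ls = ∈withoutLow⇒ δ S Y j x∈W
    in x , x∈S , λ o 1≤o o≤j → ∉lowDegree⇒ δ S (Y o) x∈S (x∉Ls o 1≤o o≤j)
    where
    W = withoutLow δ S Y j
    W≢∅ : ∣ W ∣ ≢ 0
    W≢∅ ∣W∣≡0 = <-irrefl refl (<-≤-trans je<S (begin
      ⟪ ∣ S ∣ ⟫                  ≤⟨ withoutLow-size δ S Y e j L≤e ⟩
      ⟪ ∣ W ∣ ⟫ + ⟪ j ⟫ * e      ≡⟨ cong (λ w → ⟪ w ⟫ + ⟪ j ⟫ * e) ∣W∣≡0 ⟩
      ⟪ 0 ⟫ + ⟪ j ⟫ * e          ≡⟨ trans (cong (_+ ⟪ j ⟫ * e) ⟪0⟫) (+-identityˡ _) ⟩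
      ⟪ j ⟫ * e                  ∎))
      where open ≤-Reasoning

module Residues (r : ℕ) .{{_ : NonZero r}} where

  open import Data.Nat.DivMod

  toℕ-mod : ∀ k → toℕ (k mod r) ≡ k % r
  toℕ-mod k = F.toℕ-fromℕ< (m%n<n k r)

  mod-periodic : ∀ k → (k ℕ.+ r) mod r ≡ k mod r
  mod-periodic k = F.toℕ-injective (trans (toℕ-mod (k ℕ.+ r)) (trans ([m+n]%n≡m%n k r) (sym (toℕ-mod k))))

  toℕ-mod-< : ∀ {k} → k ℕ.< r → toℕ (k mod r) ≡ k
  toℕ-mod-< k<r = trans (toℕ-mod _) (m<n⇒m%n≡m k<r)

  toℕ≡⇒mod≡ : ∀ {k} (i : Fin r) → k ≡ toℕ i → k mod r ≡ i
  toℕ≡⇒mod≡ i refl = F.toℕ-injective (toℕ-mod-< (F.toℕ<n i))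

  mod-last-block : ∀ z (i : Fin r) → ((r ℕ.* z ∸ r) ℕ.+ toℕ i) mod r ≡ i
  mod-last-block z i = F.toℕ-injective (begin
    toℕ (((r ℕ.* z ∸ r) ℕ.+ toℕ i) mod r)   ≡⟨ toℕ-mod _ ⟩
    ((r ℕ.* z ∸ r) ℕ.+ toℕ i) % r            ≡⟨ cong (_% r) blocks ⟩
    (toℕ i ℕ.+ (z ∸ 1) ℕ.* r) % r            ≡⟨ [m+kn]%n≡m%n (toℕ i) (z ∸ 1) r ⟩
    toℕ i % r                                ≡⟨ m<n⇒m%n≡m (F.toℕ<n i) ⟩
    toℕ i                                    ∎)
    where
    open ≡-Reasoning
    blocks : (r ℕ.* z ∸ r) ℕ.+ toℕ i ≡ toℕ i ℕ.+ (z ∸ 1) ℕ.* r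
    blocks = trans (ℕ.+-comm _ (toℕ i)) (cong (toℕ i ℕ.+_)
      (sym (trans (ℕ.*-distribʳ-∸ r z 1) (cong₂ _∸_ (ℕ.*-comm z r) (ℕ.*-identityˡ r)))))

  shifted-residue-≢ : ∀ {s o} → s ℕ.< r → 0 ℕ.< o → o ℕ.< r → (s ℕ.+ o) % r ≢ s
  shifted-residue-≢ {s} {o} s<r 0<o o<r eq with s ℕ.+ o ℕ.<? r
  ... | yes s+o<r = ℕ.<⇒≢ (ℕ.m<m+n s 0<o) (sym (trans (sym (m<n⇒m%n≡m s+o<r)) eq))
  ... | no  s+o≮r = ℕ.<⇒≢ o<r (ℕ.+-cancelˡ-≡ s o r (begin
      s ℕ.+ o               ≡⟨ ℕ.m∸n+n≡m r≤s+o ⟨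
      (s ℕ.+ o ∸ r) ℕ.+ r   ≡⟨ cong (ℕ._+ r) s+o-r≡s ⟩
      s ℕ.+ r               ∎))
    where
    open ≡-Reasoning
    r≤s+o = ℕ.≮⇒≥ s+o≮r
    s+o-r<r : s ℕ.+ o ∸ r ℕ.< r
    s+o-r<r = subst (s ℕ.+ o ∸ r ℕ.<_) (ℕ.m+n∸n≡m r r) (ℕ.∸-monoˡ-< (ℕ.+-mono-< s<r o<r) r≤s+o)
    s+o-r≡s : s ℕ.+ o ∸ r ≡ s
    s+o-r≡s = begin
      s ℕ.+ o ∸ r          ≡⟨ m<n⇒m%n≡m s+o-r<r ⟨
      (s ℕ.+ o ∸ r) % r    ≡⟨ m≤n⇒[n∸m]%m≡n%m r≤s+o ⟩
      (s ℕ.+ o) % r        ≡⟨ eq ⟩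
      s                    ∎

  mod-shift-≢ : ∀ k {o} → 0 ℕ.< o → o ℕ.< r → (k ℕ.+ o) mod r ≢ k mod r
  mod-shift-≢ k {o} 0<o o<r eq = shifted-residue-≢ (m%n<n k r) 0<o o<r (begin
    (k % r ℕ.+ o) % r          ≡⟨ cong (λ t → (k % r ℕ.+ t) % r) (m<n⇒m%n≡m o<r) ⟨
    (k % r ℕ.+ o % r) % r      ≡⟨ %-distribˡ-+ k o r ⟨
    (k ℕ.+ o) % r              ≡⟨ toℕ-mod (k ℕ.+ o) ⟨
    toℕ ((k ℕ.+ o) mod r)      ≡⟨ cong toℕ eq ⟩
    toℕ (k mod r)              ≡⟨ toℕ-mod k ⟩
    k % r                      ∎)
    where open ≡-Reasoning

  count : ℕ → ℕ → Fin r → ℕ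
  count a zero    i = 0
  count a (suc L) i = indicator (does (a mod r F.≟ i)) ℕ.+ count (suc a) L i

  count-++ : ∀ a L₁ L₂ i → count a (L₁ ℕ.+ L₂) i ≡ count a L₁ i ℕ.+ count (a ℕ.+ L₁) L₂ i
  count-++ a zero     L₂ i = cong (λ b → count b L₂ i) (sym (ℕ.+-identityʳ a))
  count-++ a (suc L₁) L₂ i = begin
    indicator (does (a mod r F.≟ i)) ℕ.+ count (suc a) (L₁ ℕ.+ L₂) i
      ≡⟨ cong (indicator (does (a mod r F.≟ i)) ℕ.+_) (count-++ (suc a) L₁ L₂ i) ⟩
    indicator (does (a mod r F.≟ i)) ℕ.+ (count (suc a) L₁ i ℕ.+ count (suc a ℕ.+ L₁) L₂ i)
      ≡⟨ ℕ.+-assoc (indicator (does (a mod r F.≟ i))) (count (suc a) L₁ i) _ ⟨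
    count a (suc L₁) i ℕ.+ count (suc a ℕ.+ L₁) L₂ i
      ≡⟨ cong (λ b → count a (suc L₁) i ℕ.+ count b L₂ i) (ℕ.+-suc a L₁) ⟨
    count a (suc L₁) i ℕ.+ count (a ℕ.+ suc L₁) L₂ i ∎
    where open ≡-Reasoning

  count-snoc : ∀ k i → count 0 (suc k) i ≡ count 0 k i ℕ.+ indicator (does (k mod r F.≟ i))
  count-snoc k i = trans (cong (λ L → count 0 L i) (ℕ.+-comm 1 k))
                         (trans (count-++ 0 k 1 i) (cong (count 0 k i ℕ.+_) (ℕ.+-identityʳ _)))

  count-periodic : ∀ a L i → count (a ℕ.+ r) L i ≡ count a L i
  count-periodic a zero    i = refl
  count-periodic a (suc L) i =
    cong₂ (λ c rest → indicator (does (c F.≟ i)) ℕ.+ rest) (mod-periodic a) (count-periodic (suc a) L i)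

  count-none : ∀ a L i → (∀ j → j ℕ.< L → (a ℕ.+ j) mod r ≢ i) → count a L i ≡ 0
  count-none a zero    i _    = refl
  count-none a (suc L) i miss with a mod r F.≟ i
  ... | yes a≡i = ⊥-elim (miss 0 (s≤s z≤n) (trans (cong (_mod r) (ℕ.+-identityʳ a)) a≡i))
  ... | no  _   = count-none (suc a) L i λ j j<L → miss (suc j) (s≤s j<L) ∘ trans (cong (_mod r) (ℕ.+-suc a j))

  -- Among 0, …, r - 1 only toℕ i has residue i.
  count-period : ∀ i → count 0 r i ≡ 1
  count-period i = begin
    count 0 r i                                       ≡⟨ cong (λ L → count 0 L i) r≡t+[1+u] ⟩
    count 0 (t ℕ.+ suc u) i                           ≡⟨ count-++ 0 t (suc u) i ⟩
    count 0 t i ℕ.+ count t (suc u) i                 ≡⟨ cong (ℕ._+ count t (suc u) i) (count-none 0 t i below) ⟩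
    indicator (does (t mod r F.≟ i)) ℕ.+ count (suc t) u i
      ≡⟨ cong₂ ℕ._+_ (cong indicator (dec-true (t mod r F.≟ i) (toℕ≡⇒mod≡ i refl))) (count-none (suc t) u i above) ⟩
    1                                                 ∎
    where
    open ≡-Reasoning
    t = toℕ i
    u = r ∸ suc t
    r≡t+[1+u] : r ≡ t ℕ.+ suc u
    r≡t+[1+u] = trans (sym (ℕ.m+[n∸m]≡n (F.toℕ<n i))) (sym (ℕ.+-suc t u))
    below : ∀ j → j ℕ.< t → j mod r ≢ i
    below j j<t j≡i = ℕ.<⇒≢ j<t (trans (sym (toℕ-mod-< (ℕ.<-trans j<t (F.toℕ<n i)))) (cong toℕ j≡i))
    above : ∀ j → j ℕ.< u → (suc t ℕ.+ j) mod r ≢ i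
    above j j<u 1+t+j≡i = ℕ.<⇒≢ (s≤s (ℕ.m≤m+n t j))
      (sym (trans (sym (toℕ-mod-< 1+t+j<r)) (cong toℕ 1+t+j≡i)))
      where
      1+t+j<r : suc t ℕ.+ j ℕ.< r
      1+t+j<r = subst (suc t ℕ.+ j ℕ.<_) (sym r≡t+[1+u])
        (subst (ℕ._< t ℕ.+ suc u) (ℕ.+-suc t j) (ℕ.+-monoʳ-< t (s≤s j<u)))

  count-multiple : ∀ z i → count 0 (r ℕ.* z) i ≡ z
  count-multiple zero    i = cong (λ L → count 0 L i) (ℕ.*-zeroʳ r)
  count-multiple (suc z) i = begin
    count 0 (r ℕ.* suc z) i               ≡⟨ cong (λ L → count 0 L i) (ℕ.*-suc r z) ⟩
    count 0 (r ℕ.+ r ℕ.* z) i             ≡⟨ count-++ 0 r (r ℕ.* z) i ⟩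
    count 0 r i ℕ.+ count r (r ℕ.* z) i   ≡⟨ cong₂ ℕ._+_ (count-period i) (count-periodic 0 (r ℕ.* z) i) ⟩
    suc (count 0 (r ℕ.* z) i)             ≡⟨ cong suc (count-multiple z i) ⟩
    suc z                                 ∎
    where open ≡-Reasoning

  count-≤ : ∀ {k z} → k ℕ.≤ r ℕ.* z → ∀ i → count 0 k i ℕ.≤ z
  count-≤ {k} {z} k≤rz i = subst (count 0 k i ℕ.≤_) (begin
    count 0 k i ℕ.+ count k (r ℕ.* z ∸ k) i   ≡⟨ count-++ 0 k (r ℕ.* z ∸ k) i ⟨
    count 0 (k ℕ.+ (r ℕ.* z ∸ k)) i           ≡⟨ cong (λ L → count 0 L i) (ℕ.m+[n∸m]≡n k≤rz) ⟩
    count 0 (r ℕ.* z) i                       ≡⟨ count-multiple z i ⟩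
    z                                         ∎) (ℕ.m≤m+n _ _)
    where open ≡-Reasoning

module GreedyEmbedding
  {n r : ℕ} .{{_ : NonZero r}} (G : Graph n) (part : Fin n → Fin r)
  (C C' : Fin r → Subset n) (m z : ℕ) (d ε α : ℚ)
  (∣C∣≡m : ∀ i → ∣ C i ∣ ≡ m)
  (C⊆part : ∀ i v → v ∈ C i → part v ≡ i)
  (regular : ∀ i j → i ≢ j → RegularGE G d ε (C i) (C j))
  (C'⊆C : ∀ i → C' i ⊆ C i)
  (0<d : 0ℚ < d) (d≤1 : d ≤ 1ℚ) (ε≤d/4 : ε ≤ d * ½ * ½) (0≤α : 0ℚ ≤ α)
  (0<εm : 0ℚ < ε * ⟪ m ⟫)
  (rεm≤ : ⟪ r ⟫ * (ε * ⟪ m ⟫) ≤ (d * ½) ^ (r ∸ 1) * (α * ⟪ m ⟫))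
  (C'-large : ∀ i → ⟪ z ⟫ + α * ⟪ m ⟫ ≤ ⟪ ∣ C' i ∣ ⟫)
  (filler : Fin n)
  where

  open Residues r

  δ εm A : ℚ
  δ = d * ½
  εm = ε * ⟪ m ⟫
  A = α * ⟪ m ⟫

  0≤δ : 0ℚ ≤ δ
  0≤δ = <⇒≤ (*-pos 0<d (positive⁻¹ ½))

  δ≤1 : δ ≤ 1ℚ
  δ≤1 = ≤-trans (*-monoʳ-≤′ (<⇒≤ (positive⁻¹ ½)) d≤1) (≤ᵇ⇒≤ _)

  0≤A : 0ℚ ≤ A
  0≤A = subst (_≤ A) (*-zeroʳ α) (*-monoˡ-≤′ 0≤α (⟪⟫-nonNeg m))

  1≤r : 1 ℕ.≤ r
  1≤r = ℕ.>-nonZero⁻¹ r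

  <⇒≤r∸1 : ∀ {o} → o ℕ.< r → o ℕ.≤ r ∸ 1
  <⇒≤r∸1 = ℕ.∸-monoˡ-≤ 1

  ≤r∸1⇒< : ∀ {o} → o ℕ.≤ r ∸ 1 → o ℕ.< r
  ≤r∸1⇒< o≤ = subst (suc _ ℕ.≤_) (ℕ.m+[n∸m]≡n 1≤r) (s≤s o≤)

  rεm≡ : ⟪ r ∸ 1 ⟫ * εm + εm ≡ ⟪ r ⟫ * εm
  rεm≡ = begin
    ⟪ r ∸ 1 ⟫ * εm + εm           ≡⟨ solve 2 (λ j e → j :* e :+ e := (j :+ con 1ℚ) :* e) refl ⟪ r ∸ 1 ⟫ εm ⟩
    (⟪ r ∸ 1 ⟫ + 1ℚ) * εm         ≡⟨ cong (λ t → (⟪ r ∸ 1 ⟫ + t) * εm) ⟪1⟫ ⟨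
    (⟪ r ∸ 1 ⟫ + ⟪ 1 ⟫) * εm      ≡⟨ cong (_* εm) (⟪⟫-+ (r ∸ 1) 1) ⟨
    ⟪ r ∸ 1 ℕ.+ 1 ⟫ * εm          ≡⟨ cong (λ t → ⟪ t ⟫ * εm) (ℕ.m∸n+n≡m 1≤r) ⟩
    ⟪ r ⟫ * εm                    ∎
    where
    open ≡-Reasoning
    open +-*-Solver

  εm≤δ^e*A : ∀ {e} → e ℕ.≤ r ∸ 1 → εm ≤ δ ^ e * A
  εm≤δ^e*A {e} e≤ = begin
    εm                        ≡⟨ +-identityˡ εm ⟨
    0ℚ + εm                   ≤⟨ +-monoˡ-≤ εm 0≤[r-1]εm ⟩
    ⟪ r ∸ 1 ⟫ * εm + εm       ≡⟨ rεm≡ ⟩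
    ⟪ r ⟫ * εm                ≤⟨ rεm≤ ⟩
    δ ^ (r ∸ 1) * A           ≤⟨ *-monoʳ-≤′ 0≤A (^-antimono 0≤δ δ≤1 e≤) ⟩
    δ ^ e * A                 ∎
    where
    open ≤-Reasoning
    0≤[r-1]εm : 0ℚ ≤ ⟪ r ∸ 1 ⟫ * εm
    0≤[r-1]εm = subst (_≤ ⟪ r ∸ 1 ⟫ * εm) (*-zeroʳ ⟪ r ∸ 1 ⟫) (*-monoˡ-≤′ (⟪⟫-nonNeg (r ∸ 1)) (<⇒≤ 0<εm))

  -- candidates o is the set T_o of candidates for position k + o.
  record Embedding (k : ℕ) : Set where
    field
      path       : ℕ → Fin n
      remaining  : Fin r → Subset n
      candidates : ℕ → Subset n

      path∈C'         : ∀ {j} → j ℕ.< k → path j ∈ C' (j mod r)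
      path-adjacent   : ∀ {j j'} → j ℕ.< j' → j' ℕ.< k → j' ℕ.< j ℕ.+ r → adj G (path j) (path j') ≡ true
      path-injective  : ∀ {j j'} → j ℕ.< j' → j' ℕ.< k → path j ≢ path j'
      path∉remaining  : ∀ {j} → j ℕ.< k → ∀ i → path j ∉ remaining i
      remaining⊆C'    : ∀ i → remaining i ⊆ C' i
      remaining-count : ∀ i → ∣ remaining i ∣ ℕ.+ count 0 k i ≡ ∣ C' i ∣
      used⇒on-path    : ∀ i {v} → v ∈ C' i → v ∉ remaining i → ∃[ j ] (j ℕ.< k × path j ≡ v)

      candidates⊆remaining : ∀ {o} → o ℕ.< r → candidates o ⊆ remaining ((k ℕ.+ o) mod r)
      candidates-adjacent  : ∀ {o} → o ℕ.< r → ∀ {v} → v ∈ candidates o →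
                             ∀ {j} → j ℕ.< k → k ℕ.+ o ℕ.< j ℕ.+ r → adj G (path j) v ≡ true
      candidates-large     : ∀ {o} → o ℕ.< r → δ ^ (r ∸ suc o) * A ≤ ⟪ ∣ candidates o ∣ ⟫

  start : Embedding 0
  start = record
    { path                 = λ _ → filler
    ; remaining            = C'
    ; candidates           = λ o → C' (o mod r)
    ; path∈C'              = λ ()
    ; path-adjacent        = λ _ ()
    ; path-injective       = λ _ ()
    ; path∉remaining       = λ ()
    ; remaining⊆C'         = λ _ v∈ → v∈
    ; remaining-count      = λ i → ℕ.+-identityʳ _
    ; used⇒on-path         = λ i v∈C' v∉C' → ⊥-elim (v∉C' v∈C')
    ; candidates⊆remaining = λ _ v∈ → v∈
    ; candidates-adjacent  = λ _ _ ()
    ; candidates-large     = λ {o} _ → begin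
        δ ^ (r ∸ suc o) * A   ≤⟨ *-monoʳ-≤′ 0≤A (^-antimono 0≤δ δ≤1 {0} {r ∸ suc o} z≤n) ⟩
        1ℚ * A                ≡⟨ *-identityˡ A ⟩
        A                     ≤⟨ subst (_≤ ⟪ z ⟫ + A) (+-identityˡ A) (+-monoˡ-≤ A (⟪⟫-nonNeg z)) ⟩
        ⟪ z ⟫ + A             ≤⟨ C'-large (o mod r) ⟩
        ⟪ ∣ C' (o mod r) ∣ ⟫  ∎
    }
    where open ≤-Reasoning

  module Extend {k} (E : Embedding k) (k<rz : k ℕ.< r ℕ.* z) (x : Fin n)
    (x∈T₀ : x ∈ Embedding.candidates E 0)
    (x-typical : ∀ {o} → 1 ℕ.≤ o → o ℕ.< r →
      δ * ⟪ ∣ Embedding.candidates E o ∣ ⟫ ≤ ⟪ degree G x (Embedding.candidates E o) ⟫)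
    where

    open Embedding E

    c : Fin r
    c = k mod r

    x∈remaining : x ∈ remaining c
    x∈remaining = subst (λ t → x ∈ remaining (t mod r)) (ℕ.+-identityʳ k) (candidates⊆remaining 1≤r x∈T₀)

    x∉remaining-other : ∀ {i} → i ≢ c → x ∉ remaining i
    x∉remaining-other {i} i≢c x∈Ri =
      i≢c (trans (sym (C⊆part i x (C'⊆C i (remaining⊆C' i x∈Ri)))) (C⊆part c x (C'⊆C c (remaining⊆C' c x∈remaining))))

    path' : ℕ → Fin n
    path' = path [ k ↦ x ]

    path'-old : ∀ {j} → j ℕ.< k → path' j ≡ path j
    path'-old j<k = [↦]-other path x (ℕ.<⇒≢ j<k)

    path'-new : path' k ≡ x
    path'-new = [↦]-same path k x

    remaining' : Fin r → Subset n
    remaining' i = remaining i ─ ⁅ x ⁆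

    x∉remaining' : ∀ i → x ∉ remaining' i
    x∉remaining' i x∈ = proj₂ (x∈p─q⁻ (remaining i) ⁅ x ⁆ x∈) (x∈⁅x⁆ x)

    candidates' : ℕ → Subset n
    candidates' o = if does (suc o ℕ.<? r) then candidates (suc o) ∩ neighbours G x else remaining' c

    candidates'-inner : ∀ {o} → suc o ℕ.< r → candidates' o ≡ candidates (suc o) ∩ neighbours G x
    candidates'-inner {o} 1+o<r =
      cong (if_then candidates (suc o) ∩ neighbours G x else remaining' c) (dec-true (suc o ℕ.<? r) 1+o<r)

    candidates'-last : ∀ {o} → suc o ≡ r → candidates' o ≡ remaining' c
    candidates'-last {o} 1+o≡r =
      cong (if_then candidates (suc o) ∩ neighbours G x else remaining' c) (dec-false (suc o ℕ.<? r) (ℕ.<-irrefl 1+o≡r))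

    path'∈C' : ∀ {j} → j ℕ.< suc k → path' j ∈ C' (j mod r)
    path'∈C' {j} j<1+k with ℕ.m<1+n⇒m<n∨m≡n j<1+k
    ... | inj₁ j<k  = subst (_∈ C' (j mod r)) (sym (path'-old j<k)) (path∈C' j<k)
    ... | inj₂ refl = subst (_∈ C' c) (sym path'-new) (remaining⊆C' c x∈remaining)

    path'-adjacent : ∀ {j j'} → j ℕ.< j' → j' ℕ.< suc k → j' ℕ.< j ℕ.+ r → adj G (path' j) (path' j') ≡ true
    path'-adjacent {j} {j'} j<j' j'<1+k j'<j+r with ℕ.m<1+n⇒m<n∨m≡n j'<1+k
    ... | inj₁ j'<k = subst₂ (λ u w → adj G u w ≡ true) (sym (path'-old (ℕ.<-trans j<j' j'<k))) (sym (path'-old j'<k))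
                        (path-adjacent j<j' j'<k j'<j+r)
    ... | inj₂ refl = subst₂ (λ u w → adj G u w ≡ true) (sym (path'-old j<j')) (sym path'-new)
                        (candidates-adjacent 1≤r x∈T₀ j<j' (subst (ℕ._< j ℕ.+ r) (sym (ℕ.+-identityʳ k)) j'<j+r))

    path'-injective : ∀ {j j'} → j ℕ.< j' → j' ℕ.< suc k → path' j ≢ path' j'
    path'-injective {j} {j'} j<j' j'<1+k with ℕ.m<1+n⇒m<n∨m≡n j'<1+k
    ... | inj₁ j'<k = subst₂ _≢_ (sym (path'-old (ℕ.<-trans j<j' j'<k))) (sym (path'-old j'<k)) (path-injective j<j' j'<k)
    ... | inj₂ refl = subst₂ _≢_ (sym (path'-old j<j')) (sym path'-new)
                        (λ pj≡x → path∉remaining j<j' c (subst (_∈ remaining c) (sym pj≡x) x∈remaining))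

    path'∉remaining' : ∀ {j} → j ℕ.< suc k → ∀ i → path' j ∉ remaining' i
    path'∉remaining' {j} j<1+k i with ℕ.m<1+n⇒m<n∨m≡n j<1+k
    ... | inj₁ j<k  = λ p∈ → path∉remaining j<k i (p─q⊆p (remaining i) ⁅ x ⁆ (subst (_∈ remaining' i) (path'-old j<k) p∈))
    ... | inj₂ refl = subst (_∉ remaining' i) (sym path'-new) (x∉remaining' i)

    remaining'⊆C' : ∀ i → remaining' i ⊆ C' i
    remaining'⊆C' i = ⊆-trans (p─q⊆p (remaining i) ⁅ x ⁆) (remaining⊆C' i)

    remaining'-count : ∀ i → ∣ remaining' i ∣ ℕ.+ count 0 (suc k) i ≡ ∣ C' i ∣
    remaining'-count i = trans (cong (∣ remaining' i ∣ ℕ.+_) (count-snoc k i)) (by-class (c F.≟ i))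
      where
      open ≡-Reasoning
      by-class : (c≟i : Dec (c ≡ i)) → ∣ remaining' i ∣ ℕ.+ (count 0 k i ℕ.+ indicator (does c≟i)) ≡ ∣ C' i ∣
      by-class (yes refl) = begin
        ∣ remaining' c ∣ ℕ.+ (count 0 k c ℕ.+ 1)   ≡⟨ cong (∣ remaining' c ∣ ℕ.+_) (ℕ.+-comm (count 0 k c) 1) ⟩
        ∣ remaining' c ∣ ℕ.+ suc (count 0 k c)     ≡⟨ ℕ.+-suc _ _ ⟩
        suc ∣ remaining' c ∣ ℕ.+ count 0 k c       ≡⟨ cong (ℕ._+ count 0 k c) (x∈p⇒∣p∣≡1+∣p─x∣ (remaining c) x∈remaining) ⟨
        ∣ remaining c ∣ ℕ.+ count 0 k c            ≡⟨ remaining-count c ⟩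
        ∣ C' c ∣                                   ∎
      by-class (no c≢i) = begin
        ∣ remaining' i ∣ ℕ.+ (count 0 k i ℕ.+ 0)
          ≡⟨ cong₂ ℕ._+_ (cong ∣_∣ (x∉p⇒p─x≡p (remaining i) (x∉remaining-other (c≢i ∘ sym)))) (ℕ.+-identityʳ _) ⟩
        ∣ remaining i ∣ ℕ.+ count 0 k i            ≡⟨ remaining-count i ⟩
        ∣ C' i ∣                                   ∎

    used'⇒on-path : ∀ i {v} → v ∈ C' i → v ∉ remaining' i → ∃[ j ] (j ℕ.< suc k × path' j ≡ v)
    used'⇒on-path i {v} v∈C' v∉R' with v ∈? remaining i
    ... | no v∉R = let j , j<k , pj≡v = used⇒on-path i v∈C' v∉R
                   in j , ℕ.m<n⇒m<1+n j<k , trans (path'-old j<k) pj≡v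
    ... | yes v∈R with v F.≟ x
    ...   | yes refl = k , ℕ.n<1+n k , path'-new
    ...   | no  v≢x  = ⊥-elim (v∉R' (x∈p∧x≢y⇒x∈p-y v∈R v≢x))

    candidates'⊆remaining' : ∀ {o} → o ℕ.< r → candidates' o ⊆ remaining' ((suc k ℕ.+ o) mod r)
    candidates'⊆remaining' {o} o<r {v} = [ inner , last ]′ (ℕ.m≤n⇒m<n∨m≡n o<r)
      where
      inner : suc o ℕ.< r → v ∈ candidates' o → v ∈ remaining' ((suc k ℕ.+ o) mod r)
      inner 1+o<r v∈ =
        let v∈T , v∈N = x∈p∩q⁻ (candidates (suc o)) (neighbours G x) (subst (v ∈_) (candidates'-inner 1+o<r) v∈)
        in subst (λ t → v ∈ remaining' (t mod r)) (ℕ.+-suc k o)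
             (x∈p∧x≢y⇒x∈p-y (candidates⊆remaining 1+o<r v∈T) (∈neighbours⇒≢ G v∈N))
      last : suc o ≡ r → v ∈ candidates' o → v ∈ remaining' ((suc k ℕ.+ o) mod r)
      last 1+o≡r v∈ = subst (λ t → v ∈ remaining' t) (sym last-class) (subst (v ∈_) (candidates'-last 1+o≡r) v∈)
        where
        last-class : (suc k ℕ.+ o) mod r ≡ c
        last-class = trans (cong (_mod r) (trans (sym (ℕ.+-suc k o)) (cong (k ℕ.+_) 1+o≡r))) (mod-periodic k)

    candidates'-adjacent : ∀ {o} → o ℕ.< r → ∀ {v} → v ∈ candidates' o →
      ∀ {j} → j ℕ.< suc k → suc k ℕ.+ o ℕ.< j ℕ.+ r → adj G (path' j) v ≡ true
    candidates'-adjacent {o} o<r {v} v∈ {j} j<1+k in-window = [ inner , last ]′ (ℕ.m≤n⇒m<n∨m≡n o<r)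
      where
      inner : suc o ℕ.< r → adj G (path' j) v ≡ true
      inner 1+o<r = [ old , new ]′ (ℕ.m<1+n⇒m<n∨m≡n j<1+k)
        where
        v∈T∩N = x∈p∩q⁻ (candidates (suc o)) (neighbours G x) (subst (v ∈_) (candidates'-inner 1+o<r) v∈)
        old : j ℕ.< k → adj G (path' j) v ≡ true
        old j<k = subst (λ u → adj G u v ≡ true) (sym (path'-old j<k))
          (candidates-adjacent 1+o<r (proj₁ v∈T∩N) j<k (subst (ℕ._< j ℕ.+ r) (sym (ℕ.+-suc k o)) in-window))
        new : j ≡ k → adj G (path' j) v ≡ true
        new refl = subst (λ u → adj G u v ≡ true) (sym path'-new) (∈neighbours⁻ G (proj₂ v∈T∩N))
      last : suc o ≡ r → adj G (path' j) v ≡ true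
      last 1+o≡r = ⊥-elim (ℕ.<⇒≱ (ℕ.+-cancelʳ-< r k j k+r<j+r) (ℕ.s≤s⁻¹ j<1+k))
        where
        k+r<j+r : k ℕ.+ r ℕ.< j ℕ.+ r
        k+r<j+r = subst (ℕ._< j ℕ.+ r) (trans (sym (ℕ.+-suc k o)) (cong (k ℕ.+_) 1+o≡r)) in-window

    A≤∣remaining'c∣ : A ≤ ⟪ ∣ remaining' c ∣ ⟫
    A≤∣remaining'c∣ = +-cancelˡ-≤ ⟪ z ⟫ (begin
      ⟪ z ⟫ + A                        ≤⟨ C'-large c ⟩
      ⟪ ∣ C' c ∣ ⟫                     ≤⟨ ⟪⟫-mono-≤ ∣C'c∣≤ ⟩
      ⟪ z ℕ.+ ∣ remaining' c ∣ ⟫       ≡⟨ ⟪⟫-+ z _ ⟩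
      ⟪ z ⟫ + ⟪ ∣ remaining' c ∣ ⟫     ∎)
      where
      open ≤-Reasoning
      ∣C'c∣≤ : ∣ C' c ∣ ℕ.≤ z ℕ.+ ∣ remaining' c ∣
      ∣C'c∣≤ = subst₂ ℕ._≤_ (remaining'-count c) (ℕ.+-comm _ z)
                 (ℕ.+-monoʳ-≤ ∣ remaining' c ∣ (count-≤ k<rz c))

    candidates'-large : ∀ {o} → o ℕ.< r → δ ^ (r ∸ suc o) * A ≤ ⟪ ∣ candidates' o ∣ ⟫
    candidates'-large {o} o<r = [ inner , last ]′ (ℕ.m≤n⇒m<n∨m≡n o<r)
      where
      open ≤-Reasoning
      inner : suc o ℕ.< r → δ ^ (r ∸ suc o) * A ≤ ⟪ ∣ candidates' o ∣ ⟫
      inner 1+o<r = begin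
        δ ^ (r ∸ suc o) * A                   ≡⟨ cong (λ e → δ ^ e * A) (∸≡suc∸suc 1+o<r) ⟩
        δ * δ ^ (r ∸ suc (suc o)) * A         ≡⟨ *-assoc δ _ A ⟩
        δ * (δ ^ (r ∸ suc (suc o)) * A)       ≤⟨ *-monoˡ-≤′ 0≤δ (candidates-large 1+o<r) ⟩
        δ * ⟪ ∣ candidates (suc o) ∣ ⟫         ≤⟨ x-typical (s≤s z≤n) 1+o<r ⟩
        ⟪ degree G x (candidates (suc o)) ⟫   ≡⟨ cong (λ T → ⟪ ∣ T ∣ ⟫) (candidates'-inner 1+o<r) ⟨
        ⟪ ∣ candidates' o ∣ ⟫                 ∎
      last : suc o ≡ r → δ ^ (r ∸ suc o) * A ≤ ⟪ ∣ candidates' o ∣ ⟫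
      last 1+o≡r = begin
        δ ^ (r ∸ suc o) * A                   ≡⟨ cong (λ e → δ ^ e * A) (trans (cong (r ∸_) 1+o≡r) (ℕ.n∸n≡0 r)) ⟩
        1ℚ * A                                ≡⟨ *-identityˡ A ⟩
        A                                     ≤⟨ A≤∣remaining'c∣ ⟩
        ⟪ ∣ remaining' c ∣ ⟫                  ≡⟨ cong (λ T → ⟪ ∣ T ∣ ⟫) (candidates'-last 1+o≡r) ⟨
        ⟪ ∣ candidates' o ∣ ⟫                 ∎

    extended : Embedding (suc k)
    extended = record
      { path                 = path'
      ; remaining            = remaining'
      ; candidates           = candidates'
      ; path∈C'              = path'∈C'
      ; path-adjacent        = path'-adjacent
      ; path-injective       = path'-injective
      ; path∉remaining       = path'∉remaining'
      ; remaining⊆C'         = remaining'⊆C'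
      ; remaining-count      = remaining'-count
      ; used⇒on-path         = used'⇒on-path
      ; candidates⊆remaining = candidates'⊆remaining'
      ; candidates-adjacent  = candidates'-adjacent
      ; candidates-large     = candidates'-large
      }

  step : ∀ {k} → k ℕ.< r ℕ.* z → Embedding k → Embedding (suc k)
  step {k} k<rz E =
    let x , x∈T₀ , x-typical = typical-vertex G δ T₀ candidates εm (r ∸ 1) few-low T₀-large
    in Extend.extended E k<rz x x∈T₀ (λ 1≤o o<r → x-typical _ 1≤o (<⇒≤r∸1 o<r))
    where
    open Embedding E
    T₀ = candidates 0

    candidates⊆C : ∀ {o} → o ℕ.< r → candidates o ⊆ C ((k ℕ.+ o) mod r)
    candidates⊆C o<r = ⊆-trans (candidates⊆remaining o<r) (⊆-trans (remaining⊆C' _) (C'⊆C _))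

    ε∣C∣≡εm : ∀ i → ε * ⟪ ∣ C i ∣ ⟫ ≡ εm
    ε∣C∣≡εm i = cong (λ t → ε * ⟪ t ⟫) (∣C∣≡m i)

    few-low : ∀ o → 1 ℕ.≤ o → o ℕ.≤ r ∸ 1 → ⟪ ∣ lowDegree G δ T₀ (candidates o) ∣ ⟫ ≤ εm
    few-low o 1≤o o≤r-1 =
      let d' , d≤d' , reg = regular ((k ℕ.+ 0) mod r) ((k ℕ.+ o) mod r) classes-differ
      in <⇒≤ (subst (_ <_) (ε∣C∣≡εm _)
           (lowDegree-small G 0<d d≤d' ε≤d/4 reg (candidates⊆C 1≤r) (candidates⊆C o<r)
              (subst (0ℚ <_) (sym (ε∣C∣≡εm _)) 0<εm) (subst (0ℚ <_) (sym (ε∣C∣≡εm _)) 0<εm)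
              (subst (_≤ _) (sym (ε∣C∣≡εm _)) Tₒ-large)))
      where
      o<r = ≤r∸1⇒< o≤r-1
      classes-differ : (k ℕ.+ 0) mod r ≢ (k ℕ.+ o) mod r
      classes-differ eq = mod-shift-≢ k 1≤o o<r (trans (sym eq) (cong (_mod r) (ℕ.+-identityʳ k)))
      Tₒ-large : εm ≤ ⟪ ∣ candidates o ∣ ⟫
      Tₒ-large = ≤-trans (εm≤δ^e*A (ℕ.∸-monoʳ-≤ r (s≤s z≤n))) (candidates-large o<r)

    T₀-large : ⟪ r ∸ 1 ⟫ * εm < ⟪ ∣ T₀ ∣ ⟫
    T₀-large = begin-strict
      ⟪ r ∸ 1 ⟫ * εm           ≡⟨ +-identityʳ _ ⟨
      ⟪ r ∸ 1 ⟫ * εm + 0ℚ      <⟨ +-monoʳ-< (⟪ r ∸ 1 ⟫ * εm) 0<εm ⟩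
      ⟪ r ∸ 1 ⟫ * εm + εm      ≡⟨ rεm≡ ⟩
      ⟪ r ⟫ * εm               ≤⟨ rεm≤ ⟩
      δ ^ (r ∸ 1) * A          ≤⟨ candidates-large 1≤r ⟩
      ⟪ ∣ T₀ ∣ ⟫               ∎
      where open ≤-Reasoning

  embed : ∀ k → k ℕ.≤ r ℕ.* z → Embedding k
  embed zero    _    = start
  embed (suc k) k<rz = step k<rz (embed k (ℕ.<⇒≤ k<rz))

  properly-terminated-path : 1 ℕ.≤ z →
    ∃[ p ] Σ (Fin p → Fin n) λ w →
      IsPath G r p w × ProperlyTerminated part p w
      × (∀ k → ∃[ i ] (w k ∈ C' i))
      × (∀ i → ∣ pathVertices w ∩ C' i ∣ ≡ z)
  properly-terminated-path 1≤z =
    ℓ , w , (w-injective , w-adjacent) , terminated , (λ k → toℕ k mod r , path∈C' (F.toℕ<n k)) , meets-C'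
    where
    ℓ = r ℕ.* z
    open Embedding (embed ℓ ℕ.≤-refl)

    w : Fin ℓ → Fin n
    w k = path (toℕ k)

    w-injective : ∀ a b → w a ≡ w b → a ≡ b
    w-injective a b wa≡wb with ℕ.<-cmp (toℕ a) (toℕ b)
    ... | tri< a<b _ _ = ⊥-elim (path-injective a<b (F.toℕ<n b) wa≡wb)
    ... | tri≈ _ a≡b _ = F.toℕ-injective a≡b
    ... | tri> _ _ b<a = ⊥-elim (path-injective b<a (F.toℕ<n a) (sym wa≡wb))

    w-adjacent : ∀ a b → a ≢ b →
      ∃[ s ] (s ℕ.≤ toℕ a × s ℕ.≤ toℕ b × toℕ a ℕ.< s ℕ.+ r × toℕ b ℕ.< s ℕ.+ r × s ℕ.+ r ℕ.≤ ℓ) →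
      adj G (w a) (w b) ≡ true
    w-adjacent a b a≢b (s , s≤a , s≤b , a<s+r , b<s+r , _) with ℕ.<-cmp (toℕ a) (toℕ b)
    ... | tri< a<b _ _ = path-adjacent a<b (F.toℕ<n b) (ℕ.<-≤-trans b<s+r (ℕ.+-monoˡ-≤ r s≤a))
    ... | tri≈ _ a≡b _ = ⊥-elim (a≢b (F.toℕ-injective a≡b))
    ... | tri> _ _ b<a = trans (Graph.sym G (w a) (w b))
                           (path-adjacent b<a (F.toℕ<n a) (ℕ.<-≤-trans a<s+r (ℕ.+-monoˡ-≤ r s≤b)))

    part-path : ∀ {j} → j ℕ.< ℓ → part (path j) ≡ j mod r
    part-path j<ℓ = C⊆part _ _ (C'⊆C _ (path∈C' j<ℓ))

    terminated : ProperlyTerminated part ℓ w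
    terminated =
      ℕ.m≤m*n r z {{ℕ.>-nonZero 1≤z}} ,
      (λ k i k≡i → trans (part-path (F.toℕ<n k)) (toℕ≡⇒mod≡ i k≡i)) ,
      (λ k i k≡last → trans (part-path (F.toℕ<n k)) (trans (cong (_mod r) k≡last) (mod-last-block z i)))

    path∩C'≡C'─remaining : ∀ i → pathVertices w ∩ C' i ≡ C' i ─ remaining i
    path∩C'≡C'─remaining i = ⊆-antisym ⊆C'─R C'─R⊆
      where
      ⊆C'─R : pathVertices w ∩ C' i ⊆ C' i ─ remaining i
      ⊆C'─R v∈ with x∈p∩q⁻ (pathVertices w) (C' i) v∈
      ... | v∈P , v∈C' with ∈pathVertices⁻ w v∈P
      ...   | k , refl = x∈p∧x∉q⇒x∈p─q v∈C' (path∉remaining (F.toℕ<n k) i)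
      C'─R⊆ : C' i ─ remaining i ⊆ pathVertices w ∩ C' i
      C'─R⊆ v∈ with x∈p─q⁻ (C' i) (remaining i) v∈
      ... | v∈C' , v∉R with used⇒on-path i v∈C' v∉R
      ...   | j , j<ℓ , refl = x∈p∩q⁺ (subst (_∈ pathVertices w) (cong path (F.toℕ-fromℕ< j<ℓ)) (∈pathVertices⁺ w (F.fromℕ< j<ℓ)) , v∈C')

    meets-C' : ∀ i → ∣ pathVertices w ∩ C' i ∣ ≡ z
    meets-C' i = ℕ.+-cancelˡ-≡ ∣ remaining i ∣ _ _ (begin
      ∣ remaining i ∣ ℕ.+ ∣ pathVertices w ∩ C' i ∣   ≡⟨ cong (λ S → ∣ remaining i ∣ ℕ.+ ∣ S ∣) (path∩C'≡C'─remaining i) ⟩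
      ∣ remaining i ∣ ℕ.+ ∣ C' i ─ remaining i ∣      ≡⟨ ℕ.+-comm ∣ remaining i ∣ _ ⟩
      ∣ C' i ─ remaining i ∣ ℕ.+ ∣ remaining i ∣      ≡⟨ q⊆p⇒∣p∣≡∣p─q∣+∣q∣ (C' i) (remaining i) (remaining⊆C' i) ⟨
      ∣ C' i ∣                                        ≡⟨ remaining-count i ⟨
      ∣ remaining i ∣ ℕ.+ count 0 ℓ i                 ≡⟨ cong (∣ remaining i ∣ ℕ.+_) (count-multiple z i) ⟩
      ∣ remaining i ∣ ℕ.+ z                           ∎)
      where open ≡-Reasoning

budget⇒large : ∀ (P Q : Subset n) {m z α} → ∣ P ∣ ≡ m → Q ⊆ P →
  ⟦ ∣ P ─ Q ∣ ℕ.+ z ⟧ ≤ (1ℚ - α) * ⟦ m ⟧ → ⟪ z ⟫ + α * ⟪ m ⟫ ≤ ⟪ ∣ Q ∣ ⟫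
budget⇒large P Q {m} {z} {α} ∣P∣≡m Q⊆P budget = +-cancelˡ-≤ ⟪ ∣ P ─ Q ∣ ⟫ (begin
  ⟪ ∣ P ─ Q ∣ ⟫ + (⟪ z ⟫ + α * ⟪ m ⟫)    ≡⟨ +-assoc ⟪ ∣ P ─ Q ∣ ⟫ ⟪ z ⟫ (α * ⟪ m ⟫) ⟨
  ⟪ ∣ P ─ Q ∣ ⟫ + ⟪ z ⟫ + α * ⟪ m ⟫      ≤⟨ +-monoˡ-≤ (α * ⟪ m ⟫) budget′ ⟩
  (1ℚ - α) * ⟪ m ⟫ + α * ⟪ m ⟫           ≡⟨ solve 2 (λ α m → (con 1ℚ :- α) :* m :+ α :* m := m) refl α ⟪ m ⟫ ⟩
  ⟪ m ⟫                                  ≡⟨ cong ⟪_⟫ (trans (sym ∣P∣≡m) (q⊆p⇒∣p∣≡∣p─q∣+∣q∣ P Q Q⊆P)) ⟩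
  ⟪ ∣ P ─ Q ∣ ℕ.+ ∣ Q ∣ ⟫                ≡⟨ ⟪⟫-+ ∣ P ─ Q ∣ ∣ Q ∣ ⟩
  ⟪ ∣ P ─ Q ∣ ⟫ + ⟪ ∣ Q ∣ ⟫              ∎)
  where
  open ≤-Reasoning
  open +-*-Solver
  budget′ : ⟪ ∣ P ─ Q ∣ ⟫ + ⟪ z ⟫ ≤ (1ℚ - α) * ⟪ m ⟫
  budget′ = subst₂ _≤_ (trans (sym (⟪⟫≡⟦⟧ _)) (⟪⟫-+ ∣ P ─ Q ∣ z)) (cong ((1ℚ - α) *_) (sym (⟪⟫≡⟦⟧ m))) budget

lemma8p4 : ∀ (r : ℕ) → 2 ℕ.≤ r →
    ∀ (α' : ℚ) → 0ℚ < α' → α' * ⟦ r ⟧ < 1ℚ →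
    ∃[ d₀ ] (0ℚ < d₀ × (∀ (d : ℚ) → 0ℚ < d → d ≤ d₀ →
    ∃[ ε₀ ] (0ℚ < ε₀ × (∀ (ε : ℚ) → 0ℚ < ε → ε ≤ ε₀ →
    ∃[ m₀ ] (∀ (m : ℕ) → m₀ ℕ.≤ m →
      ∀ (n : ℕ) (G : Graph n) (part : Fin n → Fin r) → IsRPartite G part →
      ∀ (C C' : Fin r → Subset n) →
      (∀ i → ∣ C i ∣ ≡ m) →
      (∀ i v → v ∈ C i → part v ≡ i) →
      (∀ i j → i ≢ j → RegularGE G d ε (C i) (C j)) →
      (∀ i → C' i ⊆ C i) →
      ∀ (z : ℕ) → 1 ℕ.≤ z →
      (∀ i → ⟦ ∣ C i ─ C' i ∣ ℕ.+ z ⟧ ≤ (1ℚ - α') * ⟦ m ⟧) →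
      ∃[ p ] Σ (Fin p → Fin n) λ w →
        IsPath G r p w × ProperlyTerminated part p w
        × (∀ k → ∃[ i ] (w k ∈ C' i))
        × (∀ i → ∣ pathVertices w ∩ C' i ∣ ≡ z))))))
-- The densities are compared with ε|C_i| exactly, without rounding, so m₀ = 1 suffices.
lemma8p4 r@(suc (suc _)) (s≤s (s≤s z≤n)) α' 0<α' α'r<1 =
  1ℚ , positive⁻¹ 1ℚ , λ d 0<d d≤1 →
  ε₀ d , ⊓-pos (*-pos (*-pos 0<d (positive⁻¹ ½)) (positive⁻¹ ½)) (*-pos (κ-pos 0<d) 0<α') , λ ε 0<ε ε≤ε₀ →
  1 , λ m 1≤m n G part _ C C' ∣C∣≡m C⊆part regular C'⊆C z 1≤z budget →
    GreedyEmbedding.properly-terminated-path G part C C' m z d ε α' ∣C∣≡m C⊆part regular C'⊆C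
      0<d d≤1 (≤-trans ε≤ε₀ (p⊓q≤p (d * ½ * ½) (κ d * α'))) (<⇒≤ 0<α') (*-pos 0<ε (⟪⟫-pos 1≤m))
      (rεm≤ 0<d m (≤-trans ε≤ε₀ (p⊓q≤q (d * ½ * ½) (κ d * α'))))
      (λ i → budget⇒large (C i) (C' i) {α = α'} (∣C∣≡m i) (C'⊆C i) (budget i))
      (proj₁ (∣p∣>0⇒nonempty (C F.zero) (subst (0 ℕ.<_) (sym (∣C∣≡m F.zero)) 1≤m)))
      1≤z
  where
  κ : ℚ → ℚ
  κ d = (d * ½) ^ (r ∸ 1) * α'

  κ-pos : ∀ {d} → 0ℚ < d → 0ℚ < κ d
  κ-pos 0<d = *-pos (^-pos (*-pos 0<d (positive⁻¹ ½)) (r ∸ 1)) 0<α'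

  -- The factor α' in κ d * α' pays for the factor r, since α' r < 1.
  ε₀ : ℚ → ℚ
  ε₀ d = (d * ½ * ½) ⊓ (κ d * α')

  rεm≤ : ∀ {d ε} → 0ℚ < d → ∀ m → ε ≤ κ d * α' → ⟪ r ⟫ * (ε * ⟪ m ⟫) ≤ (d * ½) ^ (r ∸ 1) * (α' * ⟪ m ⟫)
  rεm≤ {d} {ε} 0<d m ε≤ = begin
    ⟪ r ⟫ * (ε * ⟪ m ⟫)                ≡⟨ *-assoc ⟪ r ⟫ ε ⟪ m ⟫ ⟨
    ⟪ r ⟫ * ε * ⟪ m ⟫                  ≤⟨ *-monoʳ-≤′ (⟪⟫-nonNeg m) (⟪k⟫*ε≤κ r (<⇒≤ (κ-pos 0<d)) α'r<1′ ε≤) ⟩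
    κ d * ⟪ m ⟫                        ≡⟨ *-assoc ((d * ½) ^ (r ∸ 1)) α' ⟪ m ⟫ ⟩
    (d * ½) ^ (r ∸ 1) * (α' * ⟪ m ⟫)   ∎
    where
    open ≤-Reasoning
    α'r<1′ : α' * ⟪ r ⟫ < 1ℚ
    α'r<1′ = subst (λ t → α' * t < 1ℚ) (sym (⟪⟫≡⟦⟧ r)) α'r<1
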